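{- For $n\ge1$ let $S_n(132)$ be the set of $132$-avoiding permutations of $\{1,\dots,n\}$, and for $\sigma=\sigma_1\cdots\sigma_n$ let $\mathrm{box}(\sigma)$ be the number of indices $i$ such that $|\sigma_i-\sigma_{i+1}|=1$ or $|\sigma_{i-1}-\sigma_i|=1$ (ignoring nonexistent entries). Let $A_n(x)=\sum_{\sigma\in S_n(132)}x^{\mathrm{box}(\sigma)}$, $B_n(x)=\sum_{\sigma\in S_n(132),\sigma_1=n}x^{\mathrm{box}(\sigma)}$, $E_n(x)=\sum_{\sigma\in S_n(132),\sigma_n=n}x^{\mathrm{box}(\sigma)}$. Then for $n\ge3$, $A_n(x)|_{x^3}=F_{n-1}$ and $B_n(x)|_{x^3}=E_n(x)|_{x^3}=F_{n-3}$.
   Context: A permutation $\sigma\in S_n$ avoids $132$ if there are no indices $i<j<k$ with $\sigma_i<\sigma_k<\sigma_j$. $P(x)|_{x^m}$ denotes the coefficient of $x^m$ in the polynomial $P(x)$. The Fibonacci numbers are defined by $F_0=F_1=1$ and $F_n=F_{n-1}+F_{n-2}$ for $n\ge2$. -}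

module Defs where

open import Data.Nat using (ℕ; zero; suc; _+_; _∸_; _<_; _≤_; ∣_-_∣)
open import Data.Nat.Properties using (_≟_; _<?_)
open import Data.Fin using (Fin; toℕ) renaming (_<_ to _<ᶠ_; _<?_ to _<ᶠ?_)
open import Data.Fin.Properties using (all?)
open import Data.List using (List; []; _∷_; length; map; concatMap; filter; lookup; upTo)
open import Data.List.Relation.Unary.Unique.Propositional using (Unique)
import Data.List.Relation.Unary.Unique.DecPropositional as UDec
open import Data.Product using (Σ; _×_; _,_)
open import Data.Sum using (_⊎_)
open import Data.Maybe using (Maybe; just; nothing)
open import Relation.Binary.PropositionalEquality using (_≡_)
open import Relation.Nullary using (¬_; Dec; yes; no)
open import Relation.Nullary.Decidable using (¬?; _×-dec_; _⊎-dec_; _→-dec_)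

fib : ℕ → ℕ
fib zero = 1
fib (suc zero) = 1
fib (suc (suc n)) = fib (suc n) + fib n

-- A permutation σ = σ₁ ⋯ σₙ is represented by the word [σ₁, …, σₙ] (a List ℕ).
-- All words of length k with letters in {1, …, n}.
words : ℕ → ℕ → List (List ℕ)
words zero    n = [] ∷ []
words (suc k) n = concatMap (λ a → map (a ∷_) (words k n)) (map suc (upTo n))

Avoids132 : List ℕ → Set
Avoids132 w = (i j k : Fin (length w)) → i <ᶠ j → j <ᶠ k →
              ¬ (lookup w i < lookup w k × lookup w k < lookup w j)

avoids132? : (w : List ℕ) → Dec (Avoids132 w)
avoids132? w = all? λ i → all? λ j → all? λ k →
  (i <ᶠ? j) →-dec ((j <ᶠ? k) →-dec ¬? ((lookup w i <? lookup w k) ×-dec (lookup w k <? lookup w j)))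

-- S_n(132): words of length n over {1..n} with distinct letters (= permutations
-- of {1..n}) that avoid 132.
IsPerm132 : List ℕ → Set
IsPerm132 w = Unique w × Avoids132 w

isPerm132? : (w : List ℕ) → Dec (IsPerm132 w)
isPerm132? w = UDec.unique? _≟_ w ×-dec avoids132? w

S132 : ℕ → List (List ℕ)
S132 n = filter isPerm132? (words n n)

-- Safe indexing with ℕ (0-based); only used at in-bound indices (guarded below).
at : List ℕ → ℕ → Maybe ℕ
at []       _       = nothing
at (x ∷ _)  zero    = just x
at (_ ∷ xs) (suc i) = at xs i

Adj : List ℕ → ℕ → ℕ → Set
Adj w i j = Σ ℕ λ a → Σ ℕ λ b → at w i ≡ just a × at w j ≡ just b × ∣ a - b ∣ ≡ 1

adj? : (w : List ℕ) (i j : ℕ) → Dec (Adj w i j)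
adj? w i j with at w i | at w j
... | just a  | just b with ∣ a - b ∣ ≟ 1
...   | yes e = yes (a , b , _≡_.refl , _≡_.refl , e)
...   | no ne = no λ { (.a , .b , _≡_.refl , _≡_.refl , e) → ne e }
adj? w i j | just a  | nothing = no λ { (_ , _ , _ , () , _) }
adj? w i j | nothing | _       = no λ { (_ , _ , () , _ , _) }

InBox : List ℕ → ℕ → Set
InBox w zero    = Adj w zero 1
InBox w (suc i) = Adj w (suc i) (suc (suc i)) ⊎ Adj w i (suc i)

inBox? : (w : List ℕ) (i : ℕ) → Dec (InBox w i)
inBox? w zero    = adj? w zero 1
inBox? w (suc i) = adj? w (suc i) (suc (suc i)) ⊎-dec adj? w i (suc i)

box : List ℕ → ℕ
box w = length (filter (inBox? w) (upTo (length w)))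

HasBox : ℕ → List ℕ → Set
HasBox m w = box w ≡ m

hasBox? : (m : ℕ) (w : List ℕ) → Dec (HasBox m w)
hasBox? m w = box w ≟ m

FirstIs : ℕ → List ℕ → Set
FirstIs n w = at w 0 ≡ just n

firstIs? : (n : ℕ) (w : List ℕ) → Dec (FirstIs n w)
firstIs? n w with at w 0
... | nothing = no λ ()
... | just a with a ≟ n
...   | yes _≡_.refl = yes _≡_.refl
...   | no ne = no λ { _≡_.refl → ne _≡_.refl }

LastIs : ℕ → List ℕ → Set
LastIs n w = at w (length w ∸ 1) ≡ just n

lastIs? : (n : ℕ) (w : List ℕ) → Dec (LastIs n w)
lastIs? n w with at w (length w ∸ 1)
... | nothing = no λ ()
... | just a with a ≟ n
...   | yes _≡_.refl = yes _≡_.refl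
...   | no ne = no λ { _≡_.refl → ne _≡_.refl }

-- Coefficient of x^m in A_n(x) = Σ_{σ ∈ S_n(132)} x^{box σ}:
-- the number of σ ∈ S_n(132) with box σ = m.
A-coeff : ℕ → ℕ → ℕ
A-coeff n m = length (filter (hasBox? m) (S132 n))

B-coeff : ℕ → ℕ → ℕ
B-coeff n m = length (filter (hasBox? m) (filter (firstIs? n) (S132 n)))

E-coeff : ℕ → ℕ → ℕ
E-coeff n m = length (filter (hasBox? m) (filter (lastIs? n) (S132 n)))

-- Every σ ∈ S_n(132) with n ≥ 2 has two neighbouring entries with consecutive values: split σ = α n β
-- at its maximum, where α lies above β; then either α or β is again such a permutation with at least
-- two entries, or n−1 sits right next to n. Such a pair contributes 2 to box, and box is superadditive
-- under concatenation, so box σ = 3 leaves no room for a second pair.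
--
-- For n ≥ 3 let B_n, E_n, M_n be the σ ∈ S_n(132) with box σ = 3 whose maximum is first, last, or
-- neither. Removing a leading n+1 gives B_{n+1} ≅ E_n ⊔ M_n (a following n would force a second pair
-- in the remaining 132-avoider of size n−1 ≥ 2), and symmetrically E_{n+1} ≅ B_n ⊔ M_n. An interior
-- maximum forces σ = α (n+1) 1, since a longer β would carry a second pair, and lowering α by one and
-- appending n gives M_{n+1} ≅ E_n. Starting from |B_3| = |E_3| = |B_4| = |E_4| = 1 this yields
-- |B_n| = |E_n| = F_{n−3}, |M_n| = F_{n−4} and |A_n| = |B_n| + |E_n| + |M_n| = F_{n−1}.

module Submission where

open import Defs
open import Data.Bool using (Bool; true; false; _∨_; T)
open import Data.Bool.Properties using (T-∨; ∨-identityʳ)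
open import Data.Empty using (⊥-elim)
open import Data.Fin using (Fin) renaming (zero to fzero; suc to fsuc; _<_ to _<ᶠ_)
open import Data.List
  using (List; []; _∷_; [_]; _++_; _∷ʳ_; initLast; _∷ʳ′_; length; lookup; map; filter; applyUpTo; upTo)
open import Data.List.Properties
  using (filter-notAll; length-applyUpTo; length-++; length-map; map-++; map-injective; ++-assoc;
         ∷-injectiveʳ; ∷ʳ-injectiveˡ)
open import Data.List.Membership.Propositional using (_∈_; _∉_; lose; find)
open import Data.List.Membership.Propositional.Properties
  using (∈-∃++; ∈-++⁺ʳ; ∈-++⁺ˡ; ∈-++⁻; ∈-filter⁺; ∈-filter⁻; ∈-applyUpTo⁺; ∈-upTo⁺; ∈-upTo⁻;
         ∈-map⁺; ∈-map⁻; ∈-concatMap⁺; ∈-concatMap⁻; ∈-lookup)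
open import Data.List.Membership.Propositional.Properties.WithK using (unique∧set⇒bag)
open import Data.List.Relation.Binary.BagAndSetEquality using (∼bag⇒↭)
open import Data.List.Relation.Binary.Disjoint.Propositional using (Disjoint)
open import Data.List.Relation.Binary.Permutation.Propositional.Properties using (↭-length)
open import Data.List.Relation.Binary.Subset.Propositional using (_⊆_)
open import Data.List.Relation.Unary.All as All using (All; []; _∷_)
import Data.List.Relation.Unary.All.Properties as All
open import Data.List.Relation.Unary.Any as Any using (Any; here; there)
import Data.List.Relation.Unary.Any.Properties as Any
import Data.List.Relation.Unary.AllPairs as AllPairs
import Data.List.Relation.Unary.AllPairs.Properties as AllPairs
open import Data.List.Relation.Unary.Unique.Propositional using (Unique; []; _∷_)
import Data.List.Relation.Unary.Unique.Propositional.Properties as Unique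
open import Data.Maybe using (just)
open import Data.Maybe.Properties using (just-injective)
open import Data.Nat using (ℕ; zero; suc; pred; _+_; _∸_; _<_; _≤_; z≤n; s≤s; ∣_-_∣; _≡ᵇ_)
open import Data.Nat.Properties
open import Data.List.Membership.DecPropositional _≟_ using (_∈?_)
open import Data.Product using (Σ; ∃; _×_; _,_; proj₁; proj₂)
open import Data.Sum as Sum using (_⊎_; inj₁; inj₂; [_,_]′)
open import Function using (id; _∘_)
open import Function.Bundles using (_⇔_; mk⇔; Equivalence)
open import Function.Definitions using (Injective)
open import Relation.Binary.Definitions using (DecidableEquality; tri<; tri≈; tri>)
open import Relation.Binary.PropositionalEquality
  using (_≡_; _≢_; refl; sym; trans; cong; cong₂; subst; subst₂; module ≡-Reasoning)
open import Relation.Nullary using (¬_; yes; no; ¬?; does; contradiction)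
open import Relation.Nullary.Decidable using (_⊎-dec_; _×-dec_; T?; does-⇔)
open import Relation.Unary using (Decidable)

-- Counting duplicate-free lists

module _ {A : Set} (_≟ᴬ_ : DecidableEquality A) where

  _without_ : List A → A → List A
  ys without x = filter (λ y → ¬? (y ≟ᴬ x)) ys

  length-without-< : ∀ {x ys} → x ∈ ys → length (ys without x) < length ys
  length-without-< {x} {ys} x∈ys =
    filter-notAll (λ y → ¬? (y ≟ᴬ x)) ys (Any.map (λ { refl x≢x → x≢x refl }) x∈ys)

  ⊆-without : ∀ {x xs ys} → x ∉ xs → xs ⊆ ys → xs ⊆ ys without x
  ⊆-without x∉xs xs⊆ys y∈xs =
    ∈-filter⁺ (λ y → ¬? (y ≟ᴬ _)) (xs⊆ys y∈xs) (λ { refl → x∉xs y∈xs })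

  length-≤-unique : ∀ {xs ys} → Unique xs → xs ⊆ ys → length xs ≤ length ys
  length-≤-unique {[]}     _               _     = z≤n
  length-≤-unique {x ∷ xs} {ys} (x∉xs ∷ xs!) xs⊆ys = begin-strict
    length xs                   ≤⟨ length-≤-unique xs! (⊆-without x∉xs′ (xs⊆ys ∘ there)) ⟩
    length (ys without x)       <⟨ length-without-< (xs⊆ys (here refl)) ⟩
    length ys                   ∎
    where
    open ≤-Reasoning
    x∉xs′ : x ∉ xs
    x∉xs′ x∈xs = All.lookup x∉xs x∈xs refl

length-≡-unique : ∀ {A : Set} {xs ys : List A} → Unique xs → Unique ys → xs ⊆ ys → ys ⊆ xs →
                  length xs ≡ length ys
length-≡-unique xs! ys! xs⊆ys ys⊆xs = ↭-length (∼bag⇒↭ (unique∧set⇒bag xs! ys! (mk⇔ xs⊆ys ys⊆xs)))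

length-≡-image : ∀ {A B : Set} (f : A → B) → Injective _≡_ _≡_ f → ∀ {xs ys} → Unique xs → Unique ys →
                 (∀ {x} → x ∈ xs → f x ∈ ys) → ys ⊆ map f xs → length ys ≡ length xs
length-≡-image f f-inj {xs} xs! ys! into onto =
  trans (length-≡-unique ys! (Unique.map⁺ f-inj xs!) onto fxs⊆ys) (length-map f xs)
  where
  fxs⊆ys : map f xs ⊆ _
  fxs⊆ys y∈ with _ , x∈ , refl ← ∈-map⁻ f y∈ = into x∈

module _ {A : Set} where

  length-∷ʳ : ∀ (xs : List A) x → length (xs ∷ʳ x) ≡ suc (length xs)
  length-∷ʳ xs x = trans (length-++ xs) (+-comm (length xs) 1)

  Unique-++⁻ˡ : ∀ xs {ys : List A} → Unique (xs ++ ys) → Unique xs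
  Unique-++⁻ˡ []       _                = []
  Unique-++⁻ˡ (x ∷ xs) (x∉ ∷ xs++ys!) = All.++⁻ˡ xs x∉ ∷ Unique-++⁻ˡ xs xs++ys!

  Unique-++⁻ʳ : ∀ xs {ys : List A} → Unique (xs ++ ys) → Unique ys
  Unique-++⁻ʳ []       ys!              = ys!
  Unique-++⁻ʳ (x ∷ xs) (_ ∷ xs++ys!) = Unique-++⁻ʳ xs xs++ys!

  Unique-++-disjoint : ∀ xs {ys : List A} {v} → Unique (xs ++ ys) → v ∈ xs → v ∉ ys
  Unique-++-disjoint (x ∷ xs) (x∉ ∷ _)      (here refl)  v∈ys = All.lookup (All.++⁻ʳ xs x∉) v∈ys refl
  Unique-++-disjoint (x ∷ xs) (_ ∷ xs++ys!) (there v∈xs) = Unique-++-disjoint xs xs++ys! v∈xs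

-- Permutations of intervals

InRange : ℕ → ℕ → ℕ → Set
InRange lo m v = lo ≤ v × v < lo + m

PermOfRange : ℕ → ℕ → List ℕ → Set
PermOfRange lo m w = length w ≡ m × Unique w × All (InRange lo m) w

range : ℕ → ℕ → List ℕ
range lo m = applyUpTo (lo +_) m

∈-range⁺ : ∀ {lo m v} → InRange lo m v → v ∈ range lo m
∈-range⁺ {lo} {m} {v} (lo≤v , v<lo+m) rewrite sym (m+[n∸m]≡n lo≤v) =
  ∈-applyUpTo⁺ (lo +_) (+-cancelˡ-< lo (v ∸ lo) m v<lo+m)

length-≤-range : ∀ {lo m xs} → Unique xs → All (InRange lo m) xs → length xs ≤ m
length-≤-range {lo} {m} {xs} xs! xs∈range =
  subst (length xs ≤_) (length-applyUpTo (lo +_) m)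
    (length-≤-unique _≟_ xs! (∈-range⁺ ∘ All.lookup xs∈range))

length-≤-between : ∀ {lo hi xs} → lo ≤ hi → Unique xs → All (λ v → lo ≤ v × v < hi) xs →
                   lo + length xs ≤ hi
length-≤-between {lo} {hi} {xs} lo≤hi xs! xs-between =
  subst (lo + length xs ≤_) hi≡ (+-monoʳ-≤ lo (length-≤-range xs! (All.map in-range xs-between)))
  where
  hi≡ = m+[n∸m]≡n lo≤hi
  in-range : ∀ {v} → lo ≤ v × v < hi → InRange lo (hi ∸ lo) v
  in-range (lo≤v , v<hi) = lo≤v , subst (_ <_) (sym hi≡) v<hi

PermOfRange-∈ : ∀ {lo m w v} → PermOfRange lo m w → InRange lo m v → v ∈ w
PermOfRange-∈ {lo} {m} {w} {v} (|w| , w! , w∈range) v∈range with v ∈? w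
... | yes v∈w = v∈w
... | no  v∉w = contradiction m<m (<-irrefl refl)
  where
  open ≤-Reasoning
  w⊆range∖v = ⊆-without _≟_ v∉w (∈-range⁺ ∘ All.lookup w∈range)
  m<m : m < m
  m<m = begin-strict
    m                                   ≡⟨ sym |w| ⟩
    length w                            ≤⟨ length-≤-unique _≟_ w! w⊆range∖v ⟩
    length (_without_ _≟_ (range lo m) v) <⟨ length-without-< _≟_ (∈-range⁺ v∈range) ⟩
    length (range lo m)                 ≡⟨ length-applyUpTo (lo +_) m ⟩
    m                                   ∎

InRange-1 : ∀ {lo v} → InRange lo 1 v → v ≡ lo
InRange-1 {lo} {v} (lo≤v , v<lo+1) = ≤-antisym (≤-pred (subst (v <_) (+-comm lo 1) v<lo+1)) lo≤v

InRange-top : ∀ {lo m} → InRange lo (suc m) (lo + m)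
InRange-top {lo} {m} = m≤m+n lo m , +-monoʳ-< lo (n<1+n m)

InRange-wider : ∀ {lo m v} → InRange lo m v → InRange lo (suc m) v
InRange-wider {lo} {m} (lo≤v , v<lo+m) = lo≤v , ≤-trans v<lo+m (+-monoʳ-≤ lo (n≤1+n m))

InRange-narrower : ∀ {lo m v} → InRange lo (suc m) v → v ≢ lo + m → InRange lo m v
InRange-narrower {lo} {m} {v} (lo≤v , v<top) v≢top =
  lo≤v , ≤∧≢⇒< (≤-pred (subst (v <_) (+-suc lo m) v<top)) v≢top

InRange-bottom : ∀ {lo m} → InRange lo (suc m) lo
InRange-bottom {lo} = ≤-refl , m<m+n lo (s≤s z≤n)

InRange-above⁺ : ∀ {lo m v} → InRange (suc lo) m v → InRange lo (suc m) v
InRange-above⁺ {lo} {m} {v} (lo<v , v<top) = <⇒≤ lo<v , subst (v <_) (sym (+-suc lo m)) v<top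

InRange-above⁻ : ∀ {lo m v} → InRange lo (suc m) v → v ≢ lo → InRange (suc lo) m v
InRange-above⁻ {lo} {m} {v} (lo≤v , v<top) v≢lo =
  ≤∧≢⇒< lo≤v (v≢lo ∘ sym) , subst (v <_) (+-suc lo m) v<top

PermOfRange-∷⁺ : ∀ {lo m ρ} → PermOfRange lo m ρ → PermOfRange lo (suc m) (lo + m ∷ ρ)
PermOfRange-∷⁺ (|ρ| , ρ! , ρ∈range) =
  cong suc |ρ| , All.map (>⇒≢ ∘ proj₂) ρ∈range ∷ ρ! , InRange-top ∷ All.map InRange-wider ρ∈range

PermOfRange-∷⁻ : ∀ {lo m ρ} → PermOfRange lo (suc m) (lo + m ∷ ρ) → PermOfRange lo m ρ
PermOfRange-∷⁻ (|ρ| , top∉ρ ∷ ρ! , _ ∷ ρ∈range) =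
  suc-injective |ρ| , ρ! ,
  All.tabulate (λ v∈ρ → InRange-narrower (All.lookup ρ∈range v∈ρ) (All.lookup top∉ρ v∈ρ ∘ sym))

PermOfRange-∷ʳ⁺ : ∀ {lo m ρ} → PermOfRange lo m ρ → PermOfRange lo (suc m) (ρ ∷ʳ (lo + m))
PermOfRange-∷ʳ⁺ {ρ = ρ} (|ρ| , ρ! , ρ∈range) =
  trans (length-∷ʳ ρ _) (cong suc |ρ|) ,
  Unique.++⁺ ρ! ([] ∷ []) (λ { (v∈ρ , here refl) → <-irrefl refl (proj₂ (All.lookup ρ∈range v∈ρ)) }) ,
  All.++⁺ (All.map InRange-wider ρ∈range) (InRange-top ∷ [])

PermOfRange-∷ʳ⁻ : ∀ {lo m ρ} → PermOfRange lo (suc m) (ρ ∷ʳ (lo + m)) → PermOfRange lo m ρ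
PermOfRange-∷ʳ⁻ {ρ = ρ} (|ρ∷ʳtop| , ρ∷ʳtop! , ρ∷ʳtop∈range) =
  suc-injective (trans (sym (length-∷ʳ ρ _)) |ρ∷ʳtop|) ,
  Unique-++⁻ˡ ρ ρ∷ʳtop! ,
  All.tabulate (λ v∈ρ → InRange-narrower (All.lookup (All.++⁻ˡ ρ ρ∷ʳtop∈range) v∈ρ)
                          (λ { refl → Unique-++-disjoint ρ ρ∷ʳtop! v∈ρ (here refl) }))

PermOfRange-map-suc⁺ : ∀ {lo m ρ} → PermOfRange lo m ρ → PermOfRange (suc lo) m (map suc ρ)
PermOfRange-map-suc⁺ {ρ = ρ} (|ρ| , ρ! , ρ∈range) =
  trans (length-map suc ρ) |ρ| , Unique.map⁺ suc-injective ρ! ,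
  All.map⁺ (All.map (λ (lo≤v , v<top) → s≤s lo≤v , s≤s v<top) ρ∈range)

PermOfRange-map-suc⁻ : ∀ {lo m ρ} → PermOfRange (suc lo) m (map suc ρ) → PermOfRange lo m ρ
PermOfRange-map-suc⁻ {ρ = ρ} (|ρ| , ρ! , ρ∈range) =
  trans (sym (length-map suc ρ)) |ρ| , Unique.map⁻ ρ! ,
  All.map (λ (lo≤v , v<top) → ≤-pred lo≤v , ≤-pred v<top) (All.map⁻ ρ∈range)

PermOfRange-∷ʳ-bottom⁺ : ∀ {lo m ρ} → PermOfRange (suc lo) m ρ → PermOfRange lo (suc m) (ρ ∷ʳ lo)
PermOfRange-∷ʳ-bottom⁺ {ρ = ρ} (|ρ| , ρ! , ρ∈range) =
  trans (length-∷ʳ ρ _) (cong suc |ρ|) ,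
  Unique.++⁺ ρ! ([] ∷ []) (λ { (v∈ρ , here refl) → <-irrefl refl (proj₁ (All.lookup ρ∈range v∈ρ)) }) ,
  All.++⁺ (All.map InRange-above⁺ ρ∈range) (InRange-bottom ∷ [])

PermOfRange-∷ʳ-bottom⁻ : ∀ {lo m ρ} → PermOfRange lo (suc m) (ρ ∷ʳ lo) → PermOfRange (suc lo) m ρ
PermOfRange-∷ʳ-bottom⁻ {ρ = ρ} (|ρlo| , ρlo! , ρlo∈range) =
  suc-injective (trans (sym (length-∷ʳ ρ _)) |ρlo|) ,
  Unique-++⁻ˡ ρ ρlo! ,
  All.tabulate (λ v∈ρ → InRange-above⁻ (All.lookup (All.++⁻ˡ ρ ρlo∈range) v∈ρ)
                          (λ { refl → Unique-++-disjoint ρ ρlo! v∈ρ (here refl) }))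

-- Occurrences of 132

Between : ℕ → ℕ → ℕ → Set
Between a b c = a < c × c < b

data Has32Above (a : ℕ) : List ℕ → Set where
  start : ∀ {b xs} → Any (Between a b) xs → Has32Above a (b ∷ xs)
  skip  : ∀ {b xs} → Has32Above a xs → Has32Above a (b ∷ xs)

data Has132 : List ℕ → Set where
  start : ∀ {a xs} → Has32Above a xs → Has132 (a ∷ xs)
  skip  : ∀ {a xs} → Has132 xs → Has132 (a ∷ xs)

Has32Above⇒indices : ∀ {a xs} → Has32Above a xs →
  Σ (Fin (length xs)) λ j → Σ (Fin (length xs)) λ k → j <ᶠ k × Between a (lookup xs j) (lookup xs k)
Has32Above⇒indices (start c) = fzero , fsuc (Any.index c) , s≤s z≤n , Any.lookup-index c
Has32Above⇒indices (skip p) with j , k , j<k , a<c<b ← Has32Above⇒indices p =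
  fsuc j , fsuc k , s≤s j<k , a<c<b

indices⇒Has32Above : ∀ {a} xs (j k : Fin (length xs)) → j <ᶠ k →
  Between a (lookup xs j) (lookup xs k) → Has32Above a xs
indices⇒Has32Above (x ∷ xs) fzero    (fsuc k) _         a<c<b = start (lose (∈-lookup k) a<c<b)
indices⇒Has32Above (x ∷ xs) (fsuc j) (fsuc k) (s≤s j<k) a<c<b = skip (indices⇒Has32Above xs j k j<k a<c<b)

Avoids132⇒¬Has132 : ∀ {w} → Avoids132 w → ¬ Has132 w
Avoids132⇒¬Has132 av (start p) with j , k , j<k , a<c<b ← Has32Above⇒indices p =
  av fzero (fsuc j) (fsuc k) (s≤s z≤n) (s≤s j<k) a<c<b
Avoids132⇒¬Has132 av (skip p) =
  Avoids132⇒¬Has132 (λ i j k i<j j<k → av (fsuc i) (fsuc j) (fsuc k) (s≤s i<j) (s≤s j<k)) p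

¬Has132⇒Avoids132 : ∀ {w} → ¬ Has132 w → Avoids132 w
¬Has132⇒Avoids132 {x ∷ xs} ¬p fzero    fzero    _        ()        _
¬Has132⇒Avoids132 {x ∷ xs} ¬p fzero    (fsuc j) fzero    _         ()
¬Has132⇒Avoids132 {x ∷ xs} ¬p (fsuc i) fzero    _        ()        _
¬Has132⇒Avoids132 {x ∷ xs} ¬p (fsuc i) (fsuc j) fzero    _         ()
¬Has132⇒Avoids132 {x ∷ xs} ¬p fzero    (fsuc j) (fsuc k) _         (s≤s j<k) a<c<b =
  ¬p (start (indices⇒Has32Above xs j k j<k a<c<b))
¬Has132⇒Avoids132 {x ∷ xs} ¬p (fsuc i) (fsuc j) (fsuc k) (s≤s i<j) (s≤s j<k) =
  ¬Has132⇒Avoids132 (¬p ∘ skip) i j k i<j j<k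

Has32Above-++ˡ : ∀ {a xs} ys → Has32Above a xs → Has32Above a (xs ++ ys)
Has32Above-++ˡ ys (start c) = start (Any.++⁺ˡ c)
Has32Above-++ˡ ys (skip p)  = skip (Has32Above-++ˡ ys p)

Has32Above-++ʳ : ∀ {a} xs {ys} → Has32Above a ys → Has32Above a (xs ++ ys)
Has32Above-++ʳ []       p = p
Has32Above-++ʳ (x ∷ xs) p = skip (Has32Above-++ʳ xs p)

Has132-++ˡ : ∀ {xs} ys → Has132 xs → Has132 (xs ++ ys)
Has132-++ˡ ys (start p) = start (Has32Above-++ˡ ys p)
Has132-++ˡ ys (skip p)  = skip (Has132-++ˡ ys p)

Has132-++ʳ : ∀ xs {ys} → Has132 ys → Has132 (xs ++ ys)
Has132-++ʳ []       p = p
Has132-++ʳ (x ∷ xs) p = skip (Has132-++ʳ xs p)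

Has132-middle : ∀ {α β a b M} → a ∈ α → b ∈ β → a < b → b < M → Has132 (α ++ M ∷ β)
Has132-middle {a ∷ α} (here refl)  b∈β a<b b<M = start (Has32Above-++ʳ α (start (lose b∈β (a<b , b<M))))
Has132-middle {x ∷ α} (there a∈α) b∈β a<b b<M = skip (Has132-middle a∈α b∈β a<b b<M)

Has32Above⇒above : ∀ {a xs} → Has32Above a xs → Any (a <_) xs
Has32Above⇒above (start c) = there (Any.map proj₁ c)
Has32Above⇒above (skip p)  = there (Has32Above⇒above p)

Has132-∷-max⁻ : ∀ {x ρ} → All (_≤ x) ρ → Has132 (x ∷ ρ) → Has132 ρ
Has132-∷-max⁻ ρ≤x (start p) with c , c∈ρ , x<c ← find (Has32Above⇒above p) =
  contradiction (All.lookup ρ≤x c∈ρ) (<⇒≱ x<c)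
Has132-∷-max⁻ ρ≤x (skip p) = p

Any-∷ʳ⁻ : ∀ {A : Set} {P : A → Set} {xs x} → ¬ P x → Any P (xs ∷ʳ x) → Any P xs
Any-∷ʳ⁻ {xs = xs} ¬Px p = [ id , (λ { (here Px) → contradiction Px ¬Px }) ]′ (Any.++⁻ xs p)

Has32Above-∷ʳ⁻ : ∀ {a x ρ} → (∀ {b} → b ∈ ρ → ¬ Between a b x) →
                 Has32Above a (ρ ∷ʳ x) → Has32Above a ρ
Has32Above-∷ʳ⁻ {ρ = []}    _     (start ())
Has32Above-∷ʳ⁻ {ρ = []}    _     (skip ())
Has32Above-∷ʳ⁻ {ρ = b ∷ ρ} not-2 (start c) = start (Any-∷ʳ⁻ (not-2 (here refl)) c)
Has32Above-∷ʳ⁻ {ρ = b ∷ ρ} not-2 (skip p)  = skip (Has32Above-∷ʳ⁻ (not-2 ∘ there) p)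

Has132-∷ʳ⁻ : ∀ {x ρ} → (∀ {a b} → a ∈ ρ → b ∈ ρ → ¬ Between a b x) → Has132 (ρ ∷ʳ x) →
             Has132 ρ
Has132-∷ʳ⁻ {ρ = []}    _     (start ())
Has132-∷ʳ⁻ {ρ = []}    _     (skip ())
Has132-∷ʳ⁻ {ρ = a ∷ ρ} not-2 (start p) = start (Has32Above-∷ʳ⁻ (not-2 (here refl) ∘ there) p)
Has132-∷ʳ⁻ {ρ = a ∷ ρ} not-2 (skip p)  = skip (Has132-∷ʳ⁻ (λ a∈ b∈ → not-2 (there a∈) (there b∈)) p)

module _ {f : ℕ → ℕ} where

  Has32Above-map⁺ : (∀ {a b} → a < b → f a < f b) → ∀ {a xs} → Has32Above a xs →
                    Has32Above (f a) (map f xs)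
  Has32Above-map⁺ preserves (start c) =
    start (Any.map⁺ (Any.map (λ (a<c , c<b) → preserves a<c , preserves c<b) c))
  Has32Above-map⁺ preserves (skip p)  = skip (Has32Above-map⁺ preserves p)

  Has32Above-map⁻ : (∀ {a b} → f a < f b → a < b) → ∀ {a xs} → Has32Above (f a) (map f xs) →
                    Has32Above a xs
  Has32Above-map⁻ reflects {xs = x ∷ xs} (start c) =
    start (Any.map (λ (a<c , c<b) → reflects a<c , reflects c<b) (Any.map⁻ c))
  Has32Above-map⁻ reflects {xs = x ∷ xs} (skip p)  = skip (Has32Above-map⁻ reflects p)

  Has132-map⁺ : (∀ {a b} → a < b → f a < f b) → ∀ {xs} → Has132 xs → Has132 (map f xs)
  Has132-map⁺ preserves (start p) = start (Has32Above-map⁺ preserves p)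
  Has132-map⁺ preserves (skip p)  = skip (Has132-map⁺ preserves p)

  Has132-map⁻ : (∀ {a b} → f a < f b → a < b) → ∀ {xs} → Has132 (map f xs) → Has132 xs
  Has132-map⁻ reflects {x ∷ xs} (start p) = start (Has32Above-map⁻ reflects p)
  Has132-map⁻ reflects {x ∷ xs} (skip p)  = skip (Has132-map⁻ reflects p)

∈-words⁻ : ∀ k n {w} → w ∈ words k n → length w ≡ k × All (InRange 1 n) w
∈-words⁻ zero    n (here refl) = refl , []
∈-words⁻ (suc k) n w∈
  with a , a∈ , w∈a∷ ← find (∈-concatMap⁻ (λ a → map (a ∷_) (words k n)) {xs = map suc (upTo n)} w∈)
  with w′ , w′∈ , refl ← ∈-map⁻ (a ∷_) w∈a∷
  with i , i∈ , refl ← ∈-map⁻ suc a∈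
  with |w′| , w′∈range ← ∈-words⁻ k n w′∈
  = cong suc |w′| , (s≤s z≤n , s≤s (∈-upTo⁻ i∈)) ∷ w′∈range

∈-words⁺ : ∀ k n {w} → length w ≡ k → All (InRange 1 n) w → w ∈ words k n
∈-words⁺ zero    n {[]}        refl []                           = here refl
∈-words⁺ (suc k) n {suc i ∷ w} refl ((s≤s z≤n , s≤s i<n) ∷ w∈range) =
  ∈-concatMap⁺ (λ a → map (a ∷_) (words k n)) {xs = map suc (upTo n)}
    (lose (∈-map⁺ suc (∈-upTo⁺ i<n)) (∈-map⁺ (suc i ∷_) (∈-words⁺ k n refl w∈range)))

words-unique : ∀ k n → Unique (words k n)
words-unique zero    n = [] ∷ []
words-unique (suc k) n =
  Unique.concat⁺ (All.map⁺ (All.universal (λ _ → Unique.map⁺ ∷-injectiveʳ (words-unique k n)) _))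
                 (AllPairs.map⁺ (AllPairs.map disjoint (Unique.map⁺ suc-injective (Unique.upTo⁺ n))))
  where
  disjoint : ∀ {a b} → a ≢ b → Disjoint (map (a ∷_) (words k n)) (map (b ∷_) (words k n))
  disjoint a≢b (v∈a , v∈b) with _ , _ , refl ← ∈-map⁻ _ v∈a | _ , _ , refl ← ∈-map⁻ _ v∈b = a≢b refl

InS132 : ℕ → List ℕ → Set
InS132 n w = PermOfRange 1 n w × ¬ Has132 w

∈-S132⁻ : ∀ {n w} → w ∈ S132 n → InS132 n w
∈-S132⁻ {n} w∈
  with w∈words , w! , avoids ← ∈-filter⁻ isPerm132? {xs = words n n} w∈
  with |w| , w∈range ← ∈-words⁻ n n w∈words
  = (|w| , w! , w∈range) , Avoids132⇒¬Has132 avoids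

∈-S132⁺ : ∀ {n w} → InS132 n w → w ∈ S132 n
∈-S132⁺ {n} ((|w| , w! , w∈range) , ¬132) =
  ∈-filter⁺ isPerm132? (∈-words⁺ n n |w| w∈range) (w! , ¬Has132⇒Avoids132 ¬132)

S132-unique : ∀ n → Unique (S132 n)
S132-unique n = Unique.filter⁺ isPerm132? (words-unique n n)

-- The box statistic

indicator : Bool → ℕ
indicator true  = 1
indicator false = 0

indicator-≤-1 : ∀ b → indicator b ≤ 1
indicator-≤-1 true  = ≤-refl
indicator-≤-1 false = z≤n

indicator-∨ˡ : ∀ p q → indicator p ≤ indicator (p ∨ q)
indicator-∨ˡ true  q = ≤-refl
indicator-∨ˡ false q = z≤n

length-filter-∷ : ∀ {A : Set} {P : A → Set} (P? : Decidable P) x xs →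
  length (filter P? (x ∷ xs)) ≡ indicator (does (P? x)) + length (filter P? xs)
length-filter-∷ P? x xs with does (P? x)
... | true  = refl
... | false = refl

length-filter-applyUpTo-cong : ∀ {A B : Set} {P : A → Set} {Q : B → Set} (P? : Decidable P) (Q? : Decidable Q)
                               {f : ℕ → A} {g : ℕ → B} →
  (∀ i → P (f i) ⇔ Q (g i)) → ∀ n →
  length (filter P? (applyUpTo f n)) ≡ length (filter Q? (applyUpTo g n))
length-filter-applyUpTo-cong P? Q?         P⇔Q zero    = refl
length-filter-applyUpTo-cong P? Q? {f} {g} P⇔Q (suc n) = begin
  length (filter P? (applyUpTo f (suc n)))
    ≡⟨ length-filter-∷ P? (f 0) _ ⟩
  indicator (does (P? (f 0))) + length (filter P? (applyUpTo (f ∘ suc) n))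
    ≡⟨ cong₂ _+_ (cong indicator (does-⇔ (P⇔Q 0) (P? (f 0)) (Q? (g 0))))
                 (length-filter-applyUpTo-cong P? Q? (P⇔Q ∘ suc) n) ⟩
  indicator (does (Q? (g 0))) + length (filter Q? (applyUpTo (g ∘ suc) n))
    ≡⟨ length-filter-∷ Q? (g 0) _ ⟨
  length (filter Q? (applyUpTo g (suc n)))
    ∎
  where open ≡-Reasoning

adjacent : ℕ → ℕ → Bool
adjacent a b = ∣ a - b ∣ ≡ᵇ 1

-- boxAfter p w counts the boxed positions of w when its first entry is
-- additionally declared boxed if p holds (p records adjacency to a preceding entry).
boxAfter : Bool → List ℕ → ℕ
boxAfter p []          = 0
boxAfter p (x ∷ [])    = indicator p
boxAfter p (x ∷ y ∷ r) = indicator (p ∨ adjacent x y) + boxAfter (adjacent x y) (y ∷ r)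

BoxedAfter : Bool → List ℕ → ℕ → Set
BoxedAfter p w i = InBox w i ⊎ (i ≡ 0 × T p)

boxedAfter? : ∀ p w → Decidable (BoxedAfter p w)
boxedAfter? p w i = inBox? w i ⊎-dec ((i ≟ 0) ×-dec T? p)

Adj-head⇔ : ∀ x y r → Adj (x ∷ y ∷ r) 0 1 ⇔ T (adjacent x y)
Adj-head⇔ x y r = mk⇔ (λ { (_ , _ , refl , refl , d≡1) → ≡⇒≡ᵇ _ 1 d≡1 })
                      (λ adj → x , y , refl , refl , ≡ᵇ⇒≡ _ 1 adj)

BoxedAfter-head : ∀ p x y r → BoxedAfter p (x ∷ y ∷ r) 0 ⇔ T (p ∨ adjacent x y)
BoxedAfter-head p x y r = mk⇔
  [ (λ adj → Equivalence.from T-∨ (inj₂ (Equivalence.to (Adj-head⇔ x y r) adj))) ,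
    (λ (_ , Tp) → Equivalence.from T-∨ (inj₁ Tp)) ]′
  (λ T∨ → [ (λ Tp → inj₂ (refl , Tp)) , (inj₁ ∘ Equivalence.from (Adj-head⇔ x y r)) ]′
             (Equivalence.to T-∨ T∨))

-- Beyond position 1 both sides agree definitionally: InBox (x ∷ w) (2 + i) unfolds to InBox w (1 + i).
BoxedAfter-tail : ∀ p x y r i → BoxedAfter p (x ∷ y ∷ r) (suc i) ⇔ BoxedAfter (adjacent x y) (y ∷ r) i
BoxedAfter-tail p x y r zero = mk⇔
  (λ { (inj₁ (inj₁ adj)) → inj₁ adj
     ; (inj₁ (inj₂ adj)) → inj₂ (refl , Equivalence.to (Adj-head⇔ x y r) adj) })
  (λ { (inj₁ adj)     → inj₁ (inj₁ adj)
     ; (inj₂ (_ , Tq)) → inj₁ (inj₂ (Equivalence.from (Adj-head⇔ x y r) Tq)) })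
BoxedAfter-tail p x y r (suc i) = mk⇔ [ inj₁ , (λ ()) ∘ proj₁ ]′ [ inj₁ , (λ ()) ∘ proj₁ ]′

length-filter-boxedAfter : ∀ p w → length (filter (boxedAfter? p w) (upTo (length w))) ≡ boxAfter p w
length-filter-boxedAfter p []          = refl
length-filter-boxedAfter p (x ∷ [])    with p
... | true  = refl
... | false = refl
length-filter-boxedAfter p (x ∷ y ∷ r) = begin
  length (filter (boxedAfter? p w) (upTo (length w)))
    ≡⟨ length-filter-∷ (boxedAfter? p w) 0 _ ⟩
  indicator (does (boxedAfter? p w 0)) + length (filter (boxedAfter? p w) (applyUpTo suc (length (y ∷ r))))
    ≡⟨ cong₂ _+_ (cong indicator (does-⇔ (BoxedAfter-head p x y r) (boxedAfter? p w 0) (T? _)))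
                 (length-filter-applyUpTo-cong (boxedAfter? p w) (boxedAfter? (adjacent x y) (y ∷ r))
                   {suc} {id} (BoxedAfter-tail p x y r) (length (y ∷ r))) ⟩
  indicator (p ∨ adjacent x y) + length (filter (boxedAfter? (adjacent x y) (y ∷ r)) (upTo (length (y ∷ r))))
    ≡⟨ cong (indicator (p ∨ adjacent x y) +_) (length-filter-boxedAfter (adjacent x y) (y ∷ r)) ⟩
  boxAfter p w
    ∎
  where
  open ≡-Reasoning
  w = x ∷ y ∷ r

box≡boxAfter : ∀ w → box w ≡ boxAfter false w
box≡boxAfter w = trans
  (length-filter-applyUpTo-cong (inBox? w) (boxedAfter? false w) {id} {id}
    (λ _ → mk⇔ inj₁ [ id , (λ ()) ∘ proj₂ ]′) (length w))
  (length-filter-boxedAfter false w)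

boxAfter-false-≤ : ∀ p w → boxAfter false w ≤ boxAfter p w
boxAfter-false-≤ false w           = ≤-refl
boxAfter-false-≤ true  []          = z≤n
boxAfter-false-≤ true  (x ∷ [])    = z≤n
boxAfter-false-≤ true  (x ∷ y ∷ r) = +-monoˡ-≤ (boxAfter (adjacent x y) (y ∷ r)) (indicator-≤-1 (adjacent x y))

boxAfter-++ : ∀ p xs ys → boxAfter p xs + boxAfter false ys ≤ boxAfter p (xs ++ ys)
boxAfter-++ p []           ys      = boxAfter-false-≤ p ys
boxAfter-++ p (x ∷ [])     []      = ≤-reflexive (+-identityʳ (indicator p))
boxAfter-++ p (x ∷ [])     (y ∷ r) =
  +-mono-≤ (indicator-∨ˡ p (adjacent x y)) (boxAfter-false-≤ (adjacent x y) (y ∷ r))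
boxAfter-++ p (x ∷ x′ ∷ xs) ys     = begin
  indicator (p ∨ q) + boxAfter q (x′ ∷ xs) + boxAfter false ys   ≡⟨ +-assoc (indicator (p ∨ q)) _ _ ⟩
  indicator (p ∨ q) + (boxAfter q (x′ ∷ xs) + boxAfter false ys) ≤⟨ +-monoʳ-≤ _ (boxAfter-++ q (x′ ∷ xs) ys) ⟩
  indicator (p ∨ q) + boxAfter q (x′ ∷ xs ++ ys)                 ∎
  where
  open ≤-Reasoning
  q = adjacent x x′

box-∷-nonadjacent : ∀ {x y} r → adjacent x y ≡ false → box (x ∷ y ∷ r) ≡ box (y ∷ r)
box-∷-nonadjacent {x} {y} r x≁y = begin
  box (x ∷ y ∷ r)                                               ≡⟨ box≡boxAfter (x ∷ y ∷ r) ⟩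
  indicator (adjacent x y) + boxAfter (adjacent x y) (y ∷ r)   ≡⟨ cong (λ q → indicator q + boxAfter q (y ∷ r)) x≁y ⟩
  boxAfter false (y ∷ r)                                        ≡⟨ box≡boxAfter (y ∷ r) ⟨
  box (y ∷ r)                                                   ∎
  where open ≡-Reasoning

boxAfter-∷ʳ-nonadjacent : ∀ p ρ {l z} → adjacent l z ≡ false →
                          boxAfter p (ρ ∷ʳ l ∷ʳ z) ≡ boxAfter p (ρ ∷ʳ l)
boxAfter-∷ʳ-nonadjacent p []          l≁z rewrite l≁z = trans (+-identityʳ _) (cong indicator (∨-identityʳ p))
boxAfter-∷ʳ-nonadjacent p (x ∷ [])    {l} {z} l≁z =
  cong (indicator (p ∨ adjacent x l) +_) (boxAfter-∷ʳ-nonadjacent (adjacent x l) [] {l} {z} l≁z)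
boxAfter-∷ʳ-nonadjacent p (x ∷ y ∷ ρ) {l} {z} l≁z =
  cong (indicator (p ∨ adjacent x y) +_) (boxAfter-∷ʳ-nonadjacent (adjacent x y) (y ∷ ρ) {l} {z} l≁z)

box-∷ʳ-nonadjacent : ∀ ρ {l z} → adjacent l z ≡ false → box (ρ ∷ʳ l ∷ʳ z) ≡ box (ρ ∷ʳ l)
box-∷ʳ-nonadjacent ρ {l} {z} l≁z = begin
  box (ρ ∷ʳ l ∷ʳ z)            ≡⟨ box≡boxAfter (ρ ∷ʳ l ∷ʳ z) ⟩
  boxAfter false (ρ ∷ʳ l ∷ʳ z) ≡⟨ boxAfter-∷ʳ-nonadjacent false ρ l≁z ⟩
  boxAfter false (ρ ∷ʳ l)      ≡⟨ box≡boxAfter (ρ ∷ʳ l) ⟨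
  box (ρ ∷ʳ l)                 ∎
  where open ≡-Reasoning

boxAfter-map-suc : ∀ p w → boxAfter p (map suc w) ≡ boxAfter p w
boxAfter-map-suc p []          = refl
boxAfter-map-suc p (x ∷ [])    = refl
boxAfter-map-suc p (x ∷ y ∷ r) =
  cong (indicator (p ∨ adjacent x y) +_) (boxAfter-map-suc (adjacent x y) (y ∷ r))

box-map-suc : ∀ w → box (map suc w) ≡ box w
box-map-suc w = trans (box≡boxAfter (map suc w)) (trans (boxAfter-map-suc false w) (sym (box≡boxAfter w)))

adjacent-suc : ∀ a → T (adjacent a (suc a))
adjacent-suc zero    = _
adjacent-suc (suc a) = adjacent-suc a

adjacent-sym : ∀ a b → adjacent a b ≡ adjacent b a
adjacent-sym a b = cong (_≡ᵇ 1) (∣-∣-comm a b)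

adjacent-pred : ∀ a → T (adjacent (suc a) a)
adjacent-pred a = subst T (adjacent-sym a (suc a)) (adjacent-suc a)

adjacent⇒suc : ∀ a b → T (adjacent a b) → a ≡ suc b ⊎ b ≡ suc a
adjacent⇒suc zero    b       adj = inj₂ (≡ᵇ⇒≡ b 1 adj)
adjacent⇒suc (suc a) zero    adj = inj₁ (cong suc (≡ᵇ⇒≡ a 0 adj))
adjacent⇒suc (suc a) (suc b) adj = Sum.map (cong suc) (cong suc) (adjacent⇒suc a b adj)

nonadjacent : ∀ {a b} → a ≢ suc b → b ≢ suc a → adjacent a b ≡ false
nonadjacent {a} {b} a≢1+b b≢1+a with adjacent a b in a~b
... | false = refl
... | true  = ⊥-elim ([ a≢1+b , b≢1+a ]′ (adjacent⇒suc a b (subst T (sym a~b) _)))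

data HasAdjacentPair : List ℕ → Set where
  here  : ∀ {x y r} → T (adjacent x y) → HasAdjacentPair (x ∷ y ∷ r)
  there : ∀ {x w} → HasAdjacentPair w → HasAdjacentPair (x ∷ w)

HasAdjacentPair-++ˡ : ∀ {xs} ys → HasAdjacentPair xs → HasAdjacentPair (xs ++ ys)
HasAdjacentPair-++ˡ ys (here adj) = here adj
HasAdjacentPair-++ˡ ys (there p)  = there (HasAdjacentPair-++ˡ ys p)

1≤boxAfter-true : ∀ y r → 1 ≤ boxAfter true (y ∷ r)
1≤boxAfter-true y []      = ≤-refl
1≤boxAfter-true y (z ∷ r) = s≤s z≤n

HasAdjacentPair⇒2≤boxAfter : ∀ {w} → HasAdjacentPair w → 2 ≤ boxAfter false w
HasAdjacentPair⇒2≤boxAfter {x ∷ y ∷ r} (here adj) with adjacent x y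
... | true = s≤s (1≤boxAfter-true y r)
HasAdjacentPair⇒2≤boxAfter {x ∷ w}     (there p)  =
  ≤-trans (HasAdjacentPair⇒2≤boxAfter p) (boxAfter-++ false (x ∷ []) w)

box-++-≢3 : ∀ {xs ys} → HasAdjacentPair xs → HasAdjacentPair ys → box (xs ++ ys) ≢ 3
box-++-≢3 {xs} {ys} p q box≡3 = <-irrefl refl (begin
  4                                    ≤⟨ +-mono-≤ (HasAdjacentPair⇒2≤boxAfter p) (HasAdjacentPair⇒2≤boxAfter q) ⟩
  boxAfter false xs + boxAfter false ys ≤⟨ boxAfter-++ false xs ys ⟩
  boxAfter false (xs ++ ys)             ≡⟨ box≡boxAfter (xs ++ ys) ⟨
  box (xs ++ ys)                        ≡⟨ box≡3 ⟩
  3                                     ∎)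
  where open ≤-Reasoning

-- Splitting a 132-avoider at its maximum

data MaxSplit (lo k : ℕ) : List ℕ → Set where
  split : ∀ α β → k ≡ length α + length β →
          PermOfRange (lo + length β) (length α) α → PermOfRange lo (length β) β →
          MaxSplit lo k (α ++ lo + k ∷ β)

right<left : ∀ {α β M} → ¬ Has132 (α ++ M ∷ β) → Unique (α ++ M ∷ β) → All (_< M) β →
             ∀ {a b} → a ∈ α → b ∈ β → b < a
right<left {α} ¬132 αMβ! β<M {a} {b} a∈α b∈β with <-cmp a b
... | tri< a<b _ _ = contradiction (Has132-middle a∈α b∈β a<b (All.lookup β<M b∈β)) ¬132
... | tri≈ _ refl _ = ⊥-elim (Unique-++-disjoint α αMβ! a∈α (there b∈β))
... | tri> _ _ b<a = b<a

maxSplit : ∀ {lo k w} → PermOfRange lo (suc k) w → ¬ Has132 w → MaxSplit lo k w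
maxSplit {lo} {k} w-perm@(|w| , w! , w∈range) ¬132
  with α , β , refl ← ∈-∃++ (PermOfRange-∈ w-perm InRange-top)
  with M∉β ∷ β! ← Unique-++⁻ʳ α w!
  with _ ∷ β∈range ← All.++⁻ʳ α w∈range
  = split α β size α-perm β-perm
  where
  M = lo + k
  size : k ≡ length α + length β
  size = suc-injective (begin
    suc k                          ≡⟨ |w| ⟨
    length (α ++ M ∷ β)            ≡⟨ length-++ α ⟩
    length α + suc (length β)      ≡⟨ +-suc (length α) (length β) ⟩
    suc (length α + length β)      ∎)
    where open ≡-Reasoning
  M≡top : M ≡ lo + length β + length α
  M≡top = trans (cong (lo +_) (trans size (+-comm (length α) (length β))))
                (sym (+-assoc lo (length β) (length α)))
  α∈range : All (InRange lo (suc k)) α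
  α∈range = All.++⁻ˡ α w∈range
  α<M : ∀ {a} → a ∈ α → a < M
  α<M a∈α = proj₂ (InRange-narrower (All.lookup α∈range a∈α)
                                     (λ { refl → Unique-++-disjoint α w! a∈α (here refl) }))
  β<M : All (_< M) β
  β<M = All.tabulate λ b∈β →
    proj₂ (InRange-narrower (All.lookup β∈range b∈β) (λ { refl → All.lookup M∉β b∈β refl }))
  β<α : ∀ {a b} → a ∈ α → b ∈ β → b < a
  β<α = right<left ¬132 w! β<M
  α-perm : PermOfRange (lo + length β) (length α) α
  α-perm = refl , Unique-++⁻ˡ α w! , All.tabulate λ {a} a∈α →
    let lo≤a = proj₁ (All.lookup α∈range a∈α)
    in length-≤-between lo≤a β! (All.tabulate λ b∈β → proj₁ (All.lookup β∈range b∈β) , β<α a∈α b∈β) ,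
       subst (a <_) M≡top (α<M a∈α)
  β-perm : PermOfRange lo (length β) β
  β-perm = refl , β! , All.tabulate λ {b} b∈β →
    proj₁ (All.lookup β∈range b∈β) ,
    +-cancelʳ-≤ (length α) (suc b) (lo + length β)
      (subst (suc b + length α ≤_) M≡top
        (length-≤-between (All.lookup β<M b∈β) (Unique-++⁻ˡ α w!)
                          (All.tabulate λ a∈α → β<α a∈α b∈β , α<M a∈α)))

PermOfRange⇒HasAdjacentPair : ∀ {lo m w} → 2 ≤ m → PermOfRange lo m w → ¬ Has132 w → HasAdjacentPair w
PermOfRange⇒HasAdjacentPair {m = m} = bounded m ≤-refl
  where
  bounded : ∀ n {lo m w} → m ≤ n → 2 ≤ m → PermOfRange lo m w → ¬ Has132 w → HasAdjacentPair w
  bounded (suc n) {lo} {suc k} (s≤s k≤n) (s≤s 1≤k) w-perm ¬132 with maxSplit w-perm ¬132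
  ... | split []           []       refl _ _ = contradiction 1≤k λ ()
  ... | split []           (b ∷ []) refl _ (_ , _ , b∈range ∷ []) =
    here (subst₂ (λ x y → T (adjacent x y)) (+-comm 1 lo) (sym (InRange-1 b∈range)) (adjacent-pred lo))
  ... | split []           β@(_ ∷ _ ∷ _) refl _ β-perm =
    there (bounded n k≤n (s≤s (s≤s z≤n)) β-perm (¬132 ∘ skip))
  ... | split (a ∷ [])     β        refl (_ , _ , a∈range ∷ []) _ =
    here (subst₂ (λ x y → T (adjacent x y)) (sym (InRange-1 a∈range)) (sym (+-suc lo (length β)))
                 (adjacent-suc (lo + length β)))
  ... | split α@(_ ∷ _ ∷ _) β       refl α-perm _ =
    HasAdjacentPair-++ˡ _ (bounded n (≤-trans (m≤m+n (length α) (length β)) k≤n) (s≤s (s≤s z≤n))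
                                   α-perm (¬132 ∘ Has132-++ˡ _))

LastIs-∷ʳ : ∀ ρ x → LastIs x (ρ ∷ʳ x)
LastIs-∷ʳ []          x = refl
LastIs-∷ʳ (y ∷ [])    x = refl
LastIs-∷ʳ (y ∷ z ∷ ρ) x = LastIs-∷ʳ (z ∷ ρ) x

LastIs-∷ʳ⁻ : ∀ {n} ρ x → LastIs n (ρ ∷ʳ x) → x ≡ n
LastIs-∷ʳ⁻ ρ x last = just-injective (trans (sym (LastIs-∷ʳ ρ x)) last)

LastIs⇒∷ʳ : ∀ {n} w → LastIs n w → ∃ λ ρ → w ≡ ρ ∷ʳ n
LastIs⇒∷ʳ w last with initLast w
... | []      = contradiction last λ ()
... | ρ ∷ʳ′ x = ρ , cong (ρ ∷ʳ_) (LastIs-∷ʳ⁻ ρ x last)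

first≢last : ∀ {n w} → Unique w → 2 ≤ length w → FirstIs n w → ¬ LastIs n w
first≢last {w = w} w! 2≤|w| first last with initLast w
... | []            = contradiction 2≤|w| λ ()
... | [] ∷ʳ′ x      = contradiction 2≤|w| λ { (s≤s ()) }
... | (y ∷ ρ) ∷ʳ′ x with refl ← just-injective first | refl ← LastIs-∷ʳ⁻ (y ∷ ρ) x last
  with y∉ρy ∷ _ ← w! = All.lookup y∉ρy (∈-++⁺ʳ ρ (here refl)) refl

InS132-first≢last : ∀ {n w} → 2 ≤ n → InS132 n w → FirstIs n w → ¬ LastIs n w
InS132-first≢last 2≤n ((|w| , w! , _) , _) = first≢last w! (subst (2 ≤_) (sym |w|) 2≤n)

InS132⇒HasAdjacentPair : ∀ {n w} → 2 ≤ n → InS132 n w → HasAdjacentPair w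
InS132⇒HasAdjacentPair 2≤n (w-perm , ¬132) = PermOfRange⇒HasAdjacentPair 2≤n w-perm ¬132

InS132-∷-top⁺ : ∀ {N ρ} → InS132 N ρ → InS132 (suc N) (suc N ∷ ρ)
InS132-∷-top⁺ (ρ-perm@(_ , _ , ρ∈range) , ¬132) =
  PermOfRange-∷⁺ ρ-perm , ¬132 ∘ Has132-∷-max⁻ (All.map (<⇒≤ ∘ proj₂) ρ∈range)

InS132-∷-top⁻ : ∀ {N ρ} → InS132 (suc N) (suc N ∷ ρ) → InS132 N ρ
InS132-∷-top⁻ (ρ-perm , ¬132) = PermOfRange-∷⁻ ρ-perm , ¬132 ∘ skip

InS132-∷ʳ-top⁺ : ∀ {N ρ} → InS132 N ρ → InS132 (suc N) (ρ ∷ʳ suc N)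
InS132-∷ʳ-top⁺ (ρ-perm@(_ , _ , ρ∈range) , ¬132) =
  PermOfRange-∷ʳ⁺ ρ-perm ,
  ¬132 ∘ Has132-∷ʳ⁻ (λ _ b∈ρ (_ , top<b) → <-asym top<b (proj₂ (All.lookup ρ∈range b∈ρ)))

InS132-∷ʳ-top⁻ : ∀ {N ρ} → InS132 (suc N) (ρ ∷ʳ suc N) → InS132 N ρ
InS132-∷ʳ-top⁻ (ρ-perm , ¬132) = PermOfRange-∷ʳ⁻ ρ-perm , ¬132 ∘ Has132-++ˡ _

shift : List ℕ → List ℕ
shift ρ = map suc ρ ∷ʳ 1

shift-injective : Injective _≡_ _≡_ shift
shift-injective = map-injective suc-injective ∘ ∷ʳ-injectiveˡ _ _

InS132-shift⁺ : ∀ {N ρ} → InS132 N ρ → InS132 (suc N) (shift ρ)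
InS132-shift⁺ (ρ-perm , ¬132) =
  PermOfRange-∷ʳ-bottom⁺ sucρ-perm ,
  ¬132 ∘ Has132-map⁻ ≤-pred ∘ Has132-∷ʳ⁻ (λ a∈ _ (a<1 , _) → <-asym a<1 (above-1 a∈))
  where
  sucρ-perm = PermOfRange-map-suc⁺ ρ-perm
  above-1 : ∀ {a} → a ∈ map suc _ → 1 < a
  above-1 a∈ = proj₁ (All.lookup (proj₂ (proj₂ sucρ-perm)) a∈)

InS132-shift⁻ : ∀ {N ρ} → InS132 (suc N) (shift ρ) → InS132 N ρ
InS132-shift⁻ (perm , ¬132) =
  PermOfRange-map-suc⁻ (PermOfRange-∷ʳ-bottom⁻ perm) , ¬132 ∘ Has132-++ˡ [ 1 ] ∘ Has132-map⁺ s≤s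

box-∷-top : ∀ {N ρ} → InS132 N ρ → ¬ FirstIs N ρ → box (suc N ∷ ρ) ≡ box ρ
box-∷-top {ρ = []}    _ _ = refl
box-∷-top {N} {y ∷ r} ((_ , _ , (_ , y<1+N) ∷ _) , _) ¬first =
  box-∷-nonadjacent {suc N} r
    (nonadjacent (λ e → ¬first (cong just (sym (suc-injective e)))) (<⇒≢ (m<n⇒m<1+n y<1+N)))

box-∷ʳ-top : ∀ {N ρ} → InS132 N ρ → ¬ LastIs N ρ → box (ρ ∷ʳ suc N) ≡ box ρ
box-∷ʳ-top {N} {ρ} ((_ , _ , ρ∈range) , _) ¬last with initLast ρ
... | []       = refl
... | ρ′ ∷ʳ′ l = box-∷ʳ-nonadjacent ρ′ {l} {suc N}
  (nonadjacent (<⇒≢ (m<n⇒m<1+n l<1+N)) (λ e → ¬last (trans (LastIs-∷ʳ ρ′ l) (cong just (sym (suc-injective e))))))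
  where
  l<1+N = proj₂ (All.lookup ρ∈range (∈-++⁺ʳ ρ′ (here refl)))

box-shift : ∀ {N} → 2 ≤ N → ∀ ρ → box (shift (ρ ∷ʳ N)) ≡ box (ρ ∷ʳ N)
box-shift {N} 2≤N ρ = begin
  box (map suc (ρ ∷ʳ N) ∷ʳ 1)   ≡⟨ cong (box ∘ (_∷ʳ 1)) (map-++ suc ρ [ N ]) ⟩
  box (map suc ρ ∷ʳ suc N ∷ʳ 1) ≡⟨ box-∷ʳ-nonadjacent (map suc ρ) {suc N} {1} (nonadjacent 1+N≢2 λ ()) ⟩
  box (map suc ρ ∷ʳ suc N)      ≡⟨ cong box (map-++ suc ρ [ N ]) ⟨
  box (map suc (ρ ∷ʳ N))        ≡⟨ box-map-suc (ρ ∷ʳ N) ⟩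
  box (ρ ∷ʳ N)                  ∎
  where
  open ≡-Reasoning
  1+N≢2 : suc N ≢ 2
  1+N≢2 refl = contradiction 2≤N λ { (s≤s ()) }

shift-¬FirstIs : ∀ {N ρ} → 2 ≤ N → InS132 N ρ → LastIs N ρ → ¬ FirstIs (suc N) (shift ρ)
shift-¬FirstIs {ρ = x ∷ r} 2≤N ρ-in last first =
  InS132-first≢last 2≤N ρ-in (cong just (suc-injective (just-injective first))) last

map-suc-pred : ∀ {xs} → All (1 ≤_) xs → map suc (map pred xs) ≡ xs
map-suc-pred []             = refl
map-suc-pred (s≤s _ ∷ 1≤xs) = cong (_ ∷_) (map-suc-pred 1≤xs)

shift-pred : ∀ {N α} → All (1 ≤_) α → shift (map pred α ∷ʳ N) ≡ α ++ suc N ∷ 1 ∷ []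
shift-pred {N} {α} 1≤α = begin
  map suc (map pred α ∷ʳ N) ∷ʳ 1          ≡⟨ cong (_∷ʳ 1) (map-++ suc (map pred α) [ N ]) ⟩
  map suc (map pred α) ∷ʳ suc N ∷ʳ 1      ≡⟨ cong (λ xs → xs ∷ʳ suc N ∷ʳ 1) (map-suc-pred 1≤α) ⟩
  α ∷ʳ suc N ∷ʳ 1                         ≡⟨ ++-assoc α [ suc N ] [ 1 ] ⟩
  α ++ suc N ∷ 1 ∷ []                     ∎
  where open ≡-Reasoning

-- α ∷ʳ n and β are 132-avoiding permutations of intervals with at least two entries each.
split-box≢3 : ∀ {lo k} α β → k ≡ length α + length β →
              PermOfRange (lo + length β) (length α) α → PermOfRange lo (length β) β →
              ¬ Has132 (α ++ lo + k ∷ β) → 1 ≤ length α → 2 ≤ length β → box (α ++ lo + k ∷ β) ≢ 3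
split-box≢3 {lo} {k} α β size α-perm β-perm ¬132 1≤|α| 2≤|β| =
  subst (λ w → box w ≢ 3) (++-assoc α [ lo + k ] β) (box-++-≢3 left-pair right-pair)
  where
  top≡ : lo + length β + length α ≡ lo + k
  top≡ = trans (+-assoc lo (length β) (length α))
               (cong (lo +_) (trans (+-comm (length β) (length α)) (sym size)))
  left-pair : HasAdjacentPair (α ∷ʳ (lo + k))
  left-pair = PermOfRange⇒HasAdjacentPair (s≤s 1≤|α|)
    (subst (λ t → PermOfRange (lo + length β) (suc (length α)) (α ∷ʳ t)) top≡ (PermOfRange-∷ʳ⁺ α-perm))
    (¬132 ∘ subst Has132 (++-assoc α [ lo + k ] β) ∘ Has132-++ˡ β)
  right-pair : HasAdjacentPair β
  right-pair = PermOfRange⇒HasAdjacentPair 2≤|β| β-perm (¬132 ∘ Has132-++ʳ α ∘ skip)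

-- The three classes and their recurrences

-- Opaque, so that unification matches Box3 P? n and A₃ n by their arguments instead of unfolding them.
opaque
  Box3 : {P : List ℕ → Set} → Decidable P → ℕ → List (List ℕ)
  Box3 P? n = filter (hasBox? 3) (filter P? (S132 n))

  A₃ : ℕ → List (List ℕ)
  A₃ n = filter (hasBox? 3) (S132 n)

Interior : ℕ → List ℕ → Set
Interior n w = ¬ FirstIs n w × ¬ LastIs n w

interior? : ∀ n → Decidable (Interior n)
interior? n w = ¬? (firstIs? n w) ×-dec ¬? (lastIs? n w)

B₃ E₃ M₃ : ℕ → List (List ℕ)
B₃ n = Box3 (firstIs? n) n
E₃ n = Box3 (lastIs? n) n
M₃ n = Box3 (interior? n) n

opaque
  unfolding Box3 A₃

  ∈-Box3⁻ : ∀ {P : List ℕ → Set} (P? : Decidable P) {n w} → w ∈ Box3 P? n →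
            InS132 n w × box w ≡ 3 × P w
  ∈-Box3⁻ P? {n} w∈
    with w∈P , box≡3 ← ∈-filter⁻ (hasBox? 3) {xs = filter P? (S132 n)} w∈
    with w∈S , Pw ← ∈-filter⁻ P? w∈P
    = ∈-S132⁻ w∈S , box≡3 , Pw

  ∈-Box3⁺ : ∀ {P : List ℕ → Set} (P? : Decidable P) {n w} → InS132 n w → box w ≡ 3 → P w →
            w ∈ Box3 P? n
  ∈-Box3⁺ P? w-in box≡3 Pw = ∈-filter⁺ (hasBox? 3) (∈-filter⁺ P? (∈-S132⁺ w-in) Pw) box≡3

  Box3-unique : ∀ {P : List ℕ → Set} (P? : Decidable P) n → Unique (Box3 P? n)
  Box3-unique P? n = Unique.filter⁺ (hasBox? 3) (Unique.filter⁺ P? (S132-unique n))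

  ∈-A₃⁻ : ∀ {n w} → w ∈ A₃ n → InS132 n w × box w ≡ 3
  ∈-A₃⁻ {n} w∈ with w∈S , box≡3 ← ∈-filter⁻ (hasBox? 3) {xs = S132 n} w∈ = ∈-S132⁻ w∈S , box≡3

  ∈-A₃⁺ : ∀ {n w} → InS132 n w → box w ≡ 3 → w ∈ A₃ n
  ∈-A₃⁺ w-in box≡3 = ∈-filter⁺ (hasBox? 3) (∈-S132⁺ w-in) box≡3

  A₃-unique : ∀ n → Unique (A₃ n)
  A₃-unique n = Unique.filter⁺ (hasBox? 3) (S132-unique n)

  A-coeff≡ : ∀ n → A-coeff n 3 ≡ length (A₃ n)
  A-coeff≡ n = refl

  B-coeff≡ : ∀ n → B-coeff n 3 ≡ length (B₃ n)
  B-coeff≡ n = refl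

  E-coeff≡ : ∀ n → E-coeff n 3 ≡ length (E₃ n)
  E-coeff≡ n = refl

Box3⊆A₃ : ∀ {P : List ℕ → Set} (P? : Decidable P) {n} → Box3 P? n ⊆ A₃ n
Box3⊆A₃ P? w∈ with w-in , box≡3 , _ ← ∈-Box3⁻ P? w∈ = ∈-A₃⁺ w-in box≡3

E₃-M₃-disjoint : ∀ {n} → Disjoint (E₃ n) (M₃ n)
E₃-M₃-disjoint {n} (w∈E , w∈M)
  with _ , _ , last ← ∈-Box3⁻ (lastIs? n) w∈E | _ , _ , _ , ¬last ← ∈-Box3⁻ (interior? n) w∈M =
  ¬last last

B₃-M₃-disjoint : ∀ {n} → Disjoint (B₃ n) (M₃ n)
B₃-M₃-disjoint {n} (w∈B , w∈M)
  with _ , _ , first ← ∈-Box3⁻ (firstIs? n) w∈B | _ , _ , ¬first , _ ← ∈-Box3⁻ (interior? n) w∈M =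
  ¬first first

B₃-E₃-disjoint : ∀ {n} → 2 ≤ n → Disjoint (B₃ n) (E₃ n)
B₃-E₃-disjoint {n} 2≤n (w∈B , w∈E)
  with w-in , _ , first ← ∈-Box3⁻ (firstIs? n) w∈B | _ , _ , last ← ∈-Box3⁻ (lastIs? n) w∈E =
  InS132-first≢last 2≤n w-in first last

∈-E₃++M₃⁻ : ∀ {N ρ} → 2 ≤ N → ρ ∈ E₃ N ++ M₃ N → InS132 N ρ × box ρ ≡ 3 × ¬ FirstIs N ρ
∈-E₃++M₃⁻ {N} 2≤N ρ∈ with ∈-++⁻ (E₃ N) ρ∈
... | inj₁ ρ∈E with ρ-in , box≡3 , last ← ∈-Box3⁻ (lastIs? N) ρ∈E =
  ρ-in , box≡3 , λ first → InS132-first≢last 2≤N ρ-in first last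
... | inj₂ ρ∈M with ρ-in , box≡3 , ¬first , _ ← ∈-Box3⁻ (interior? N) ρ∈M = ρ-in , box≡3 , ¬first

∈-E₃++M₃⁺ : ∀ {N ρ} → InS132 N ρ → box ρ ≡ 3 → ¬ FirstIs N ρ → ρ ∈ E₃ N ++ M₃ N
∈-E₃++M₃⁺ {N} {ρ} ρ-in box≡3 ¬first with lastIs? N ρ
... | yes last  = ∈-++⁺ˡ (∈-Box3⁺ (lastIs? N) ρ-in box≡3 last)
... | no  ¬last = ∈-++⁺ʳ (E₃ N) (∈-Box3⁺ (interior? N) ρ-in box≡3 (¬first , ¬last))

∈-B₃++M₃⁻ : ∀ {N ρ} → 2 ≤ N → ρ ∈ B₃ N ++ M₃ N → InS132 N ρ × box ρ ≡ 3 × ¬ LastIs N ρ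
∈-B₃++M₃⁻ {N} 2≤N ρ∈ with ∈-++⁻ (B₃ N) ρ∈
... | inj₁ ρ∈B with ρ-in , box≡3 , first ← ∈-Box3⁻ (firstIs? N) ρ∈B =
  ρ-in , box≡3 , InS132-first≢last 2≤N ρ-in first
... | inj₂ ρ∈M with ρ-in , box≡3 , _ , ¬last ← ∈-Box3⁻ (interior? N) ρ∈M = ρ-in , box≡3 , ¬last

∈-B₃++M₃⁺ : ∀ {N ρ} → InS132 N ρ → box ρ ≡ 3 → ¬ LastIs N ρ → ρ ∈ B₃ N ++ M₃ N
∈-B₃++M₃⁺ {N} {ρ} ρ-in box≡3 ¬last with firstIs? N ρ
... | yes first  = ∈-++⁺ˡ (∈-Box3⁺ (firstIs? N) ρ-in box≡3 first)
... | no  ¬first = ∈-++⁺ʳ (B₃ N) (∈-Box3⁺ (interior? N) ρ-in box≡3 (¬first , ¬last))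

box≡3⇒¬FirstIs : ∀ {N ρ} → 3 ≤ N → InS132 (suc N) (suc N ∷ ρ) → box (suc N ∷ ρ) ≡ 3 → ¬ FirstIs N ρ
box≡3⇒¬FirstIs {suc n} {y ∷ r} (s≤s 2≤n) z-in box≡3 first with refl ← just-injective first =
  box-++-≢3 {suc (suc n) ∷ suc n ∷ []} (here (adjacent-pred (suc n)))
    (InS132⇒HasAdjacentPair 2≤n (InS132-∷-top⁻ (InS132-∷-top⁻ z-in))) box≡3

box≡3⇒¬LastIs : ∀ {N ρ} → 3 ≤ N → InS132 (suc N) (ρ ∷ʳ suc N) → box (ρ ∷ʳ suc N) ≡ 3 → ¬ LastIs N ρ
box≡3⇒¬LastIs {suc n} {ρ} (s≤s 2≤n) z-in box≡3 last with ρ′ , refl ← LastIs⇒∷ʳ ρ last =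
  box-++-≢3 (InS132⇒HasAdjacentPair 2≤n (InS132-∷ʳ-top⁻ (InS132-∷ʳ-top⁻ z-in))) (here (adjacent-suc (suc n)))
    (trans (cong box (sym (++-assoc ρ′ _ _))) box≡3)

B₃-step : ∀ {N} → 3 ≤ N → length (B₃ (suc N)) ≡ length (E₃ N) + length (M₃ N)
B₃-step {N} 3≤N = begin
  length (B₃ (suc N))            ≡⟨ length-≡-image (suc N ∷_) ∷-injectiveʳ EM! (Box3-unique _ _) into onto ⟩
  length (E₃ N ++ M₃ N)          ≡⟨ length-++ (E₃ N) ⟩
  length (E₃ N) + length (M₃ N)  ∎
  where
  open ≡-Reasoning
  EM! = Unique.++⁺ (Box3-unique _ N) (Box3-unique _ N) E₃-M₃-disjoint
  into : ∀ {ρ} → ρ ∈ E₃ N ++ M₃ N → suc N ∷ ρ ∈ B₃ (suc N)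
  into ρ∈ with ρ-in , box≡3 , ¬first ← ∈-E₃++M₃⁻ (≤-trans (n≤1+n 2) 3≤N) ρ∈ =
    ∈-Box3⁺ (firstIs? (suc N)) (InS132-∷-top⁺ ρ-in) (trans (box-∷-top ρ-in ¬first) box≡3) refl
  onto : B₃ (suc N) ⊆ map (suc N ∷_) (E₃ N ++ M₃ N)
  onto {[]}    z∈ = contradiction (proj₂ (proj₂ (∈-Box3⁻ (firstIs? (suc N)) z∈))) λ ()
  onto {x ∷ ρ} z∈ with z-in , box≡3 , first ← ∈-Box3⁻ (firstIs? (suc N)) z∈ with refl ← just-injective first =
    ∈-map⁺ (suc N ∷_) (∈-E₃++M₃⁺ ρ-in (trans (sym (box-∷-top ρ-in ¬first)) box≡3) ¬first)
    where
    ρ-in = InS132-∷-top⁻ z-in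
    ¬first = box≡3⇒¬FirstIs 3≤N z-in box≡3

E₃-step : ∀ {N} → 3 ≤ N → length (E₃ (suc N)) ≡ length (B₃ N) + length (M₃ N)
E₃-step {N} 3≤N = begin
  length (E₃ (suc N))            ≡⟨ length-≡-image (_∷ʳ suc N) (∷ʳ-injectiveˡ _ _) BM! (Box3-unique _ _) into onto ⟩
  length (B₃ N ++ M₃ N)          ≡⟨ length-++ (B₃ N) ⟩
  length (B₃ N) + length (M₃ N)  ∎
  where
  open ≡-Reasoning
  BM! = Unique.++⁺ (Box3-unique _ N) (Box3-unique _ N) B₃-M₃-disjoint
  into : ∀ {ρ} → ρ ∈ B₃ N ++ M₃ N → ρ ∷ʳ suc N ∈ E₃ (suc N)
  into {ρ} ρ∈ with ρ-in , box≡3 , ¬last ← ∈-B₃++M₃⁻ (≤-trans (n≤1+n 2) 3≤N) ρ∈ =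
    ∈-Box3⁺ (lastIs? (suc N)) (InS132-∷ʳ-top⁺ ρ-in) (trans (box-∷ʳ-top ρ-in ¬last) box≡3) (LastIs-∷ʳ ρ (suc N))
  onto : E₃ (suc N) ⊆ map (_∷ʳ suc N) (B₃ N ++ M₃ N)
  onto {z} z∈ with z-in , box≡3 , last ← ∈-Box3⁻ (lastIs? (suc N)) z∈ with ρ , refl ← LastIs⇒∷ʳ z last =
    ∈-map⁺ (_∷ʳ suc N) (∈-B₃++M₃⁺ ρ-in (trans (sym (box-∷ʳ-top ρ-in ¬last)) box≡3) ¬last)
    where
    ρ-in = InS132-∷ʳ-top⁻ z-in
    ¬last = box≡3⇒¬LastIs 3≤N z-in box≡3

M₃-step : ∀ {N} → 3 ≤ N → length (M₃ (suc N)) ≡ length (E₃ N)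
M₃-step {N} 3≤N =
  length-≡-image shift shift-injective (Box3-unique (lastIs? N) N) (Box3-unique (interior? (suc N)) (suc N))
                 into onto
  where
  2≤N = ≤-trans (n≤1+n 2) 3≤N
  into : ∀ {ρ} → ρ ∈ E₃ N → shift ρ ∈ M₃ (suc N)
  into {ρ} ρ∈ with ρ-in , box≡3 , last ← ∈-Box3⁻ (lastIs? N) ρ∈ with ρ′ , refl ← LastIs⇒∷ʳ ρ last =
    ∈-Box3⁺ (interior? (suc N)) (InS132-shift⁺ ρ-in) (trans (box-shift 2≤N ρ′) box≡3)
      (shift-¬FirstIs 2≤N ρ-in last , <⇒≢ (s≤s (≤-trans (s≤s z≤n) 2≤N)) ∘ LastIs-∷ʳ⁻ (map suc (ρ′ ∷ʳ N)) 1)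
  onto : M₃ (suc N) ⊆ map shift (E₃ N)
  onto z∈ with z-in@(z-perm , ¬132) , box≡3 , ¬first , ¬last ← ∈-Box3⁻ (interior? (suc N)) z∈
    with maxSplit z-perm ¬132
  ... | split []          β          _    _      _ = contradiction refl ¬first
  ... | split α           []         _    _      _ = contradiction (LastIs-∷ʳ α (suc N)) ¬last
  ... | split α@(_ ∷ _)   β@(_ ∷ _ ∷ _) size α-perm β-perm =
    contradiction box≡3 (split-box≢3 α β size α-perm β-perm ¬132 (s≤s z≤n) (s≤s (s≤s z≤n)))
  ... | split α@(_ ∷ _)   (b ∷ [])   _    (_ , _ , α∈range) (_ , _ , b∈range ∷ []) with refl ← InRange-1 b∈range =
    subst (_∈ map shift (E₃ N)) z≡ (∈-map⁺ shift ρ∈E)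
    where
    ρ = map pred α ∷ʳ N
    z≡ : shift ρ ≡ α ++ suc N ∷ 1 ∷ []
    z≡ = shift-pred (All.map (λ (2≤a , _) → <⇒≤ 2≤a) α∈range)
    ρ∈E : ρ ∈ E₃ N
    ρ∈E = ∈-Box3⁺ (lastIs? N) (InS132-shift⁻ (subst (InS132 (suc N)) (sym z≡) z-in))
            (trans (sym (box-shift 2≤N (map pred α))) (trans (cong box z≡) box≡3)) (LastIs-∷ʳ (map pred α) N)

A₃-partition : ∀ {n} → 2 ≤ n → length (A₃ n) ≡ length (B₃ n) + (length (E₃ n) + length (M₃ n))
A₃-partition {n} 2≤n = begin
  length (A₃ n)                                  ≡⟨ length-≡-unique (A₃-unique n) BEM! A⊆BEM BEM⊆A ⟩
  length (B₃ n ++ E₃ n ++ M₃ n)                  ≡⟨ length-++ (B₃ n) ⟩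
  length (B₃ n) + length (E₃ n ++ M₃ n)          ≡⟨ cong (length (B₃ n) +_) (length-++ (E₃ n)) ⟩
  length (B₃ n) + (length (E₃ n) + length (M₃ n)) ∎
  where
  open ≡-Reasoning
  BEM! : Unique (B₃ n ++ E₃ n ++ M₃ n)
  BEM! = Unique.++⁺ (Box3-unique _ n) (Unique.++⁺ (Box3-unique _ n) (Box3-unique _ n) E₃-M₃-disjoint)
           (λ (w∈B , w∈EM) → [ (λ w∈E → B₃-E₃-disjoint 2≤n (w∈B , w∈E)) ,
                                 (λ w∈M → B₃-M₃-disjoint (w∈B , w∈M)) ]′ (∈-++⁻ (E₃ n) w∈EM))
  A⊆BEM : A₃ n ⊆ B₃ n ++ E₃ n ++ M₃ n
  A⊆BEM {w} w∈ with w-in , box≡3 ← ∈-A₃⁻ w∈ with firstIs? n w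
  ... | yes first  = ∈-++⁺ˡ (∈-Box3⁺ (firstIs? n) w-in box≡3 first)
  ... | no  ¬first = ∈-++⁺ʳ (B₃ n) (∈-E₃++M₃⁺ w-in box≡3 ¬first)
  BEM⊆A : B₃ n ++ E₃ n ++ M₃ n ⊆ A₃ n
  BEM⊆A w∈ with ∈-++⁻ (B₃ n) w∈
  ... | inj₁ w∈B = Box3⊆A₃ (firstIs? n) w∈B
  ... | inj₂ w∈EM = [ Box3⊆A₃ (lastIs? n) , Box3⊆A₃ (interior? n) ]′ (∈-++⁻ (E₃ n) w∈EM)

B₃-E₃-count : ∀ k → length (B₃ (3 + k)) ≡ fib k × length (E₃ (3 + k)) ≡ fib k
B₃-E₃-count 0 = sym (B-coeff≡ 3) , sym (E-coeff≡ 3)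
B₃-E₃-count 1 = sym (B-coeff≡ 4) , sym (E-coeff≡ 4)
B₃-E₃-count (suc (suc k)) with B-k , E-k ← B₃-E₃-count k | B-k+1 , E-k+1 ← B₃-E₃-count (suc k) =
  (begin
    length (B₃ (5 + k))                       ≡⟨ B₃-step (m≤m+n 3 (1 + k)) ⟩
    length (E₃ (4 + k)) + length (M₃ (4 + k)) ≡⟨ cong₂ _+_ E-k+1 M-k+1 ⟩
    fib (2 + k)                               ∎) ,
  (begin
    length (E₃ (5 + k))                       ≡⟨ E₃-step (m≤m+n 3 (1 + k)) ⟩
    length (B₃ (4 + k)) + length (M₃ (4 + k)) ≡⟨ cong₂ _+_ B-k+1 M-k+1 ⟩
    fib (2 + k)                               ∎)
  where
  open ≡-Reasoning
  M-k+1 : length (M₃ (4 + k)) ≡ fib k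
  M-k+1 = trans (M₃-step (m≤m+n 3 k)) E-k

A₃-count : ∀ k → length (A₃ (3 + k)) ≡ fib (2 + k)
A₃-count zero    = sym (A-coeff≡ 3)
A₃-count (suc k) with B , E ← B₃-E₃-count (suc k) = begin
  length (A₃ (4 + k))                                               ≡⟨ A₃-partition (m≤m+n 2 (2 + k)) ⟩
  length (B₃ (4 + k)) + (length (E₃ (4 + k)) + length (M₃ (4 + k))) ≡⟨ cong₂ _+_ B (cong₂ _+_ E M) ⟩
  fib (1 + k) + fib (2 + k)                                         ≡⟨ +-comm (fib (1 + k)) (fib (2 + k)) ⟩
  fib (3 + k)                                                       ∎
  where
  open ≡-Reasoning
  M : length (M₃ (4 + k)) ≡ fib k
  M = trans (M₃-step (m≤m+n 3 k)) (proj₂ (B₃-E₃-count k))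

theorem4 : (n : ℕ) → 3 ≤ n →
    (A-coeff n 3 ≡ fib (n ∸ 1)) × (B-coeff n 3 ≡ fib (n ∸ 3)) × (E-coeff n 3 ≡ fib (n ∸ 3))
theorem4 (suc (suc (suc k))) (s≤s (s≤s (s≤s _))) =
  trans (A-coeff≡ (3 + k)) (A₃-count k) ,
  trans (B-coeff≡ (3 + k)) (proj₁ (B₃-E₃-count k)) ,
  trans (E-coeff≡ (3 + k)) (proj₂ (B₃-E₃-count k))
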